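{- Let $G$ be a finite transitive permutation group on a set $V$, and let $H,K\le G$ be subgroups such that $H\cup K$ is an intersecting set. Then $HK=\{hk: h\in H, k\in K\}$ is also an intersecting set.
   Context: A subset $\mathcal{F}\subseteq G$ is intersecting if for any $g,h\in\mathcal{F}$ there is $v\in V$ with $g(v)=h(v)$. -}

module Defs where

open import Level using (0ℓ)
open import Data.Nat using (ℕ)
open import Data.Fin using (Fin)
open import Data.Fin.Permutation using (Permutation′; _⟨$⟩ʳ_; _≈_; id; flip; _∘ₚ_)
open import Data.Product using (Σ; ∃; _×_)
open import Relation.Binary.PropositionalEquality using (_≡_)
open import Relation.Unary using (Pred; _⊆_; _∈_; _∪_)

Perm : ℕ → Set
Perm n = Permutation′ n

PermSet : ℕ → Set₁
PermSet n = Pred (Perm n) 0ℓ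

-- Group product: (g · h) v = g (h v)   (h acts first).
_·_ : ∀ {n} → Perm n → Perm n → Perm n
g · h = h ∘ₚ g

-- It is automatically finite.
record IsPermGroup {n : ℕ} (G : PermSet n) : Set where
  field
    resp  : ∀ {g h} → g ≈ h → g ∈ G → h ∈ G
    idG   : id ∈ G
    mulG  : ∀ {g h} → g ∈ G → h ∈ G → (g · h) ∈ G
    invG  : ∀ {g} → g ∈ G → flip g ∈ G

IsSubgroup : ∀ {n} → PermSet n → PermSet n → Set
IsSubgroup H G = IsPermGroup H × (H ⊆ G)

IsTransitive : ∀ {n} → PermSet n → Set
IsTransitive {n} G = ∀ (u v : Fin n) → ∃ λ g → g ∈ G × (g ⟨$⟩ʳ u ≡ v)

Intersecting : ∀ {n} → PermSet n → Set
Intersecting {n} F = ∀ g h → g ∈ F → h ∈ F → ∃ λ (v : Fin n) → g ⟨$⟩ʳ v ≡ h ⟨$⟩ʳ v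

ProdSet : ∀ {n} → PermSet n → PermSet n → PermSet n
ProdSet H K σ = ∃ λ h → ∃ λ k → h ∈ H × k ∈ K × (σ ≈ (h · k))

{-# OPTIONS --safe #-}
module Submission where

-- hk and h'k' agree at k⁻¹ w exactly when h'⁻¹h ∈ H and k'k⁻¹ ∈ K agree
-- at w, and any two elements of H ∪ K agree somewhere.

open import Defs
open import Data.Nat using (ℕ)
open import Data.Fin using (Fin)
open import Data.Product using (_,_)
open import Data.Sum using (inj₁; inj₂)
open import Data.Fin.Permutation using (_⟨$⟩ʳ_; _⟨$⟩ˡ_; _≈_; flip; inverseʳ)
open import Relation.Binary.PropositionalEquality using (_≡_; cong; sym; module ≡-Reasoning)
open import Relation.Unary using (_∈_; _∪_)

left-quotient∈ : ∀ {n} {G : PermSet n} {g g′} → IsPermGroup G →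
  g ∈ G → g′ ∈ G → (flip g′ · g) ∈ G
left-quotient∈ isGroup g∈G g′∈G = mulG (invG g′∈G) g∈G
  where open IsPermGroup isGroup

right-quotient∈ : ∀ {n} {G : PermSet n} {g g′} → IsPermGroup G →
  g ∈ G → g′ ∈ G → (g′ · flip g) ∈ G
right-quotient∈ isGroup g∈G g′∈G = mulG g′∈G (invG g∈G)
  where open IsPermGroup isGroup

·-agree-from-quotients : ∀ {n} (σ τ h k h′ k′ : Perm n) (w : Fin n) →
  σ ≈ (h · k) → τ ≈ (h′ · k′) →
  (flip h′ · h) ⟨$⟩ʳ w ≡ (k′ · flip k) ⟨$⟩ʳ w →
  σ ⟨$⟩ʳ (k ⟨$⟩ˡ w) ≡ τ ⟨$⟩ʳ (k ⟨$⟩ˡ w)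
·-agree-from-quotients σ τ h k h′ k′ w σ≈hk τ≈h′k′ agree = begin
  σ ⟨$⟩ʳ v                       ≡⟨ σ≈hk v ⟩
  h ⟨$⟩ʳ (k ⟨$⟩ʳ (k ⟨$⟩ˡ w))     ≡⟨ cong (h ⟨$⟩ʳ_) (inverseʳ k) ⟩
  h ⟨$⟩ʳ w                       ≡⟨ sym (inverseʳ h′) ⟩
  h′ ⟨$⟩ʳ (h′ ⟨$⟩ˡ (h ⟨$⟩ʳ w))   ≡⟨ cong (h′ ⟨$⟩ʳ_) agree ⟩
  h′ ⟨$⟩ʳ (k′ ⟨$⟩ʳ v)            ≡⟨ sym (τ≈h′k′ v) ⟩
  τ ⟨$⟩ʳ v                       ∎
  where
  open ≡-Reasoning
  v = k ⟨$⟩ˡ w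

ProdSet-intersecting : ∀ {n} {H K : PermSet n} → IsPermGroup H → IsPermGroup K →
  Intersecting (H ∪ K) → Intersecting (ProdSet H K)
ProdSet-intersecting isGroupH isGroupK intersecting σ τ
  (h , k , h∈H , k∈K , σ≈hk) (h′ , k′ , h′∈H , k′∈K , τ≈h′k′)
  with intersecting (flip h′ · h) (k′ · flip k)
         (inj₁ (left-quotient∈ isGroupH h∈H h′∈H))
         (inj₂ (right-quotient∈ isGroupK k∈K k′∈K))
... | w , agree = k ⟨$⟩ˡ w , ·-agree-from-quotients σ τ h k h′ k′ w σ≈hk τ≈h′k′ agree

lemma5p1 : (n : ℕ) (G H K : PermSet n) → IsPermGroup G → IsTransitive G →
    IsSubgroup H G → IsSubgroup K G → Intersecting (H ∪ K) →
    Intersecting (ProdSet H K)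
lemma5p1 n G H K _ _ (isGroupH , _) (isGroupK , _) =
  ProdSet-intersecting isGroupH isGroupK
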